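{- Let $\hat g\in\mathbb{R}[[t]]$ be even with $\hat g(0)\neq0$ and $\hat f_1,\hat f_2\in\mathbb{R}[[t]]$ odd of order $1$, and suppose the compressed double Riordan array $(\hat g;\hat f_1,\hat f_2)$ is totally positive. Then for every $\alpha>0$ the compressed double almost-Riordan array $(t\hat g+\alpha\,|\,\hat g;\hat f_1,\hat f_2)$ is totally positive.
   Context: The compressed double almost-Riordan array $(\hat b|\hat g;\hat f_1,\hat f_2)$ is the infinite lower triangular matrix whose $k$-th column has generating function $\hat b$ for $k=0$, $t\hat g(\hat f_1\hat f_2)^{\ell}$ for $k=2\ell+1$, and $t\hat g\hat f_1(\hat f_1\hat f_2)^{\ell}$ for $k=2\ell+2$. The compressed double Riordan array $(\hat g;\hat f_1,\hat f_2)$ is the infinite lower triangular matrix whose $k$-th column has generating function $\hat g(\hat f_1\hat f_2)^{\ell}$ for $k=2\ell$ and $\hat g\hat f_1(\hat f_1\hat f_2)^{\ell}$ for $k=2\ell+1$. A matrix is totally positive if all its minors are nonnegative. -}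

module Defs where

open import Data.Nat as ℕ using (ℕ; zero; suc; _∸_; _%_; _/_; _≡ᵇ_)
open import Data.Bool using (if_then_else_)
open import Data.Fin as Fin using (Fin; zero; suc; punchIn)
open import Data.Product using (Σ; ∃; _×_; _,_)
open import Relation.Binary.PropositionalEquality using (_≡_)
open import Relation.Binary.Structures using (IsTotalOrder)
open import Relation.Nullary using (¬_)
open import Algebra.Structures using (IsCommutativeRing)

-- The real numbers, axiomatised as a complete ordered field
-- (any model is isomorphic to ℝ).
record RealField : Set₁ where
  infixl 6 _+_
  infixl 7 _*_
  infix 4 _≤_
  field
    Carrier : Set
    _+_ _*_ : Carrier → Carrier → Carrier
    -_ : Carrier → Carrier
    0# 1# : Carrier
    _≤_ : Carrier → Carrier → Set
    isCommutativeRing : IsCommutativeRing _≡_ _+_ _*_ -_ 0# 1#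
    isTotalOrder : IsTotalOrder _≡_ _≤_
    0≢1 : ¬ (0# ≡ 1#)
    inverse : ∀ x → ¬ (x ≡ 0#) → Σ Carrier (λ y → x * y ≡ 1#)
    +-mono-≤ : ∀ {x y} z → x ≤ y → x + z ≤ y + z
    *-nonneg : ∀ {x y} → 0# ≤ x → 0# ≤ y → 0# ≤ x * y
    complete : (P : Carrier → Set) → Σ Carrier P →
               Σ Carrier (λ b → ∀ x → P x → x ≤ b) →
               Σ Carrier (λ s → (∀ x → P x → x ≤ s) ×
                                (∀ b → (∀ x → P x → x ≤ b) → s ≤ b))

  _<_ : Carrier → Carrier → Set
  x < y = (x ≤ y) × ¬ (x ≡ y)

module _ (R : RealField) where
  open RealField R

  PowerSeries : Set
  PowerSeries = ℕ → Carrier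

  sumBelow : (ℕ → Carrier) → ℕ → Carrier
  sumBelow f zero = 0#
  sumBelow f (suc n) = sumBelow f n + f n

  sumFin : ∀ {n} → (Fin n → Carrier) → Carrier
  sumFin {zero} f = 0#
  sumFin {suc n} f = f zero + sumFin (λ i → f (suc i))

  psAdd : PowerSeries → PowerSeries → PowerSeries
  psAdd a b n = a n + b n

  psMul : PowerSeries → PowerSeries → PowerSeries
  psMul a b n = sumBelow (λ i → a i * b (n ∸ i)) (suc n)

  psConst : Carrier → PowerSeries
  psConst c zero = c
  psConst c (suc n) = 0#

  psOne : PowerSeries
  psOne = psConst 1#

  psPow : PowerSeries → ℕ → PowerSeries
  psPow a zero = psOne
  psPow a (suc l) = psMul a (psPow a l)

  psT : PowerSeries → PowerSeries
  psT a zero = 0#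
  psT a (suc n) = a n

  Even : PowerSeries → Set
  Even a = ∀ n → a (suc (2 ℕ.* n)) ≡ 0#

  Odd : PowerSeries → Set
  Odd a = ∀ n → a (2 ℕ.* n) ≡ 0#

  HasOrder1 : PowerSeries → Set
  HasOrder1 a = (a 0 ≡ 0#) × ¬ (a 1 ≡ 0#)

  InfMatrix : Set
  InfMatrix = ℕ → ℕ → Carrier

  -- k-th column generating function of the compressed double Riordan array
  -- (g ; f1 , f2): g (f1 f2)^l for k = 2l, g f1 (f1 f2)^l for k = 2l+1
  cdRiordanCol : PowerSeries → PowerSeries → PowerSeries → ℕ → PowerSeries
  cdRiordanCol g f1 f2 k =
    if k % 2 ≡ᵇ 0
    then psMul g (psPow (psMul f1 f2) (k / 2))
    else psMul (psMul g f1) (psPow (psMul f1 f2) (k / 2))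

  cdRiordan : PowerSeries → PowerSeries → PowerSeries → InfMatrix
  cdRiordan g f1 f2 n k = cdRiordanCol g f1 f2 k n

  -- compressed double almost-Riordan array (b | g ; f1 , f2):
  -- column 0 is b, column 2l+1 is t g (f1 f2)^l, column 2l+2 is t g f1 (f1 f2)^l
  cdAlmostRiordanCol : PowerSeries → PowerSeries → PowerSeries → PowerSeries → ℕ → PowerSeries
  cdAlmostRiordanCol b g f1 f2 zero = b
  cdAlmostRiordanCol b g f1 f2 (suc k) = psT (cdRiordanCol g f1 f2 k)

  cdAlmostRiordan : PowerSeries → PowerSeries → PowerSeries → PowerSeries → InfMatrix
  cdAlmostRiordan b g f1 f2 n k = cdAlmostRiordanCol b g f1 f2 k n

  altSign : ℕ → Carrier
  altSign zero = 1#
  altSign (suc n) = - altSign n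

  det : ∀ {m} → (Fin m → Fin m → Carrier) → Carrier
  det {zero} A = 1#
  det {suc m} A =
    sumFin (λ j → altSign (Fin.toℕ j) * A zero j * det (λ r c → A (suc r) (punchIn j c)))

  StrictlyIncreasing : ∀ {m} → (Fin m → ℕ) → Set
  StrictlyIncreasing {m} r = ∀ (i j : Fin m) → i Fin.< j → r i ℕ.< r j

  TotallyPositive : InfMatrix → Set
  TotallyPositive M =
    ∀ (m : ℕ) (r c : Fin m → ℕ) → StrictlyIncreasing r → StrictlyIncreasing c →
    0# ≤ det (λ i j → M (r i) (c j))

-- Deleting the top row of (tĝ + α | ĝ; f̂₁, f̂₂) leaves the compressed double Riordan
-- array D = (ĝ; f̂₁, f̂₂) with its first column ĝ written twice, and the top row itself is
-- (α, 0, 0, …). A minor using the top row is therefore α times a minor of the remaining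
-- rows, or 0. A minor avoiding it is 0 when it uses both copies of ĝ, and otherwise it
-- is a minor of D.
module Submission where

open import Defs
open import Data.Nat as ℕ using (ℕ; zero; suc; z≤n; s≤s; z<s; s<s)
open import Data.Nat.Properties as ℕ using ()
open import Data.Fin as Fin using (Fin; zero; suc; punchIn)
open import Data.Product using (_,_)
open import Data.Sum using (_⊎_; inj₁; inj₂)
open import Function using (_∘_)
open import Relation.Binary.PropositionalEquality
  using (_≡_; refl; sym; trans; cong; cong₂; subst; module ≡-Reasoning)
open import Relation.Binary.Structures using (IsTotalOrder)
open import Relation.Nullary using (¬_)
open import Algebra.Bundles using (Ring)
open import Algebra.Structures using (IsCommutativeRing)
import Algebra.Properties.Ring as RingProperties

pred-mono-<′ : ∀ {a b} → a ℕ.< b → 1 ℕ.≤ a ⊎ 2 ℕ.≤ b → ℕ.pred a ℕ.< ℕ.pred b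
pred-mono-<′ {zero}  {suc _} _         (inj₁ ())
pred-mono-<′ {zero}  {suc _} _         (inj₂ (s≤s 1≤b)) = 1≤b
pred-mono-<′ {suc _} {suc _} (s<s a<b) _                = a<b

module _ (R : RealField) where
  open RealField R
  open IsCommutativeRing isCommutativeRing
    using (isRing; +-identityˡ; +-identityʳ; *-identityˡ; *-identityʳ; zeroˡ; zeroʳ; -‿inverseʳ)
  open IsTotalOrder isTotalOrder using () renaming (reflexive to ≤-reflexive)
  open ≡-Reasoning

  private
    ring : Ring _ _
    ring = record { isRing = isRing }

  open RingProperties ring using (-1*x≈-x; -‿distribˡ-*)

  private
    SI : ∀ {m} → (Fin m → ℕ) → Set
    SI = StrictlyIncreasing R

  tail-strictlyIncreasing : ∀ {m} {c : Fin (suc m) → ℕ} → SI c → SI (c ∘ suc)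
  tail-strictlyIncreasing sic i j i<j = sic (suc i) (suc j) (s<s i<j)

  tail-positive : ∀ {m} {c : Fin (suc m) → ℕ} → SI c → ∀ j → 1 ℕ.≤ c (suc j)
  tail-positive sic j = ℕ.≤-trans (s≤s z≤n) (sic zero (suc j) z<s)

  positive-from-head : ∀ {m} {c : Fin (suc m) → ℕ} → SI c → 1 ℕ.≤ c zero → ∀ i → 1 ℕ.≤ c i
  positive-from-head sic 1≤c₀ zero    = 1≤c₀
  positive-from-head sic 1≤c₀ (suc i) = tail-positive sic i

  second≤tail : ∀ {m} {c : Fin (suc (suc m)) → ℕ} → SI c → ∀ j → c (suc zero) ℕ.≤ c (suc j)
  second≤tail sic zero    = ℕ.≤-refl
  second≤tail sic (suc j) = ℕ.<⇒≤ (sic (suc zero) (suc (suc j)) (s<s z<s))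

  pred-strictlyIncreasing : ∀ {m} {c : Fin m → ℕ} → SI c →
    (∀ i j → i Fin.< j → 1 ℕ.≤ c i ⊎ 2 ℕ.≤ c j) → SI (ℕ.pred ∘ c)
  pred-strictlyIncreasing sic away i j i<j = pred-mono-<′ (sic i j i<j) (away i j i<j)

  sumBelow-zero : ∀ (f : ℕ → Carrier) n → (∀ i → i ℕ.< n → f i ≡ 0#) → sumBelow R f n ≡ 0#
  sumBelow-zero f zero    _  = refl
  sumBelow-zero f (suc n) f₀ = begin
    sumBelow R f n + f n  ≡⟨ cong₂ _+_ (sumBelow-zero f n (λ i i<n → f₀ i (ℕ.m≤n⇒m≤1+n i<n)))
                                       (f₀ n ℕ.≤-refl) ⟩
    0# + 0#               ≡⟨ +-identityʳ 0# ⟩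
    0#                    ∎

  psConst-∸-vanishes : ∀ c {i n} → i ℕ.< n → psConst R c (n ℕ.∸ i) ≡ 0#
  psConst-∸-vanishes c {zero}  {suc _} _         = refl
  psConst-∸-vanishes c {suc i} {suc n} (s<s i<n) = psConst-∸-vanishes c i<n

  psMul-identityʳ : ∀ (a : PowerSeries R) n → psMul R a (psOne R) n ≡ a n
  psMul-identityʳ a n = begin
    sumBelow R (λ i → a i * psOne R (n ℕ.∸ i)) n + a n * psOne R (n ℕ.∸ n)
      ≡⟨ cong₂ _+_ (sumBelow-zero _ n λ i i<n →
                      trans (cong (a i *_) (psConst-∸-vanishes 1# i<n)) (zeroʳ (a i)))
                   (cong (λ k → a n * psOne R k) (ℕ.n∸n≡0 n)) ⟩
    0# + a n * 1#  ≡⟨ +-identityˡ _ ⟩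
    a n * 1#       ≡⟨ *-identityʳ (a n) ⟩
    a n            ∎

  sumFin-cong : ∀ {n} {f h : Fin n → Carrier} → (∀ i → f i ≡ h i) → sumFin R f ≡ sumFin R h
  sumFin-cong {zero}  f≡h = refl
  sumFin-cong {suc n} f≡h = cong₂ _+_ (f≡h zero) (sumFin-cong (f≡h ∘ suc))

  sumFin-zero : ∀ {n} (f : Fin n → Carrier) → (∀ i → f i ≡ 0#) → sumFin R f ≡ 0#
  sumFin-zero {zero}  f f₀ = refl
  sumFin-zero {suc n} f f₀ =
    trans (cong₂ _+_ (f₀ zero) (sumFin-zero (f ∘ suc) (f₀ ∘ suc))) (+-identityʳ 0#)

  det-cong : ∀ {m} {A B : Fin m → Fin m → Carrier} → (∀ i j → A i j ≡ B i j) → det R A ≡ det R B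
  det-cong {zero}  A≡B = refl
  det-cong {suc m} A≡B = sumFin-cong λ j →
    cong₂ (λ a d → altSign R (Fin.toℕ j) * a * d) (A≡B zero j)
          (det-cong λ r c → A≡B (suc r) (punchIn j c))

  laplace-term-vanishes : ∀ s {a} d → a ≡ 0# → s * a * d ≡ 0#
  laplace-term-vanishes s d refl = trans (cong (_* d) (zeroʳ s)) (zeroˡ d)

  det-firstRow-sparse : ∀ {m} (A : Fin (suc m) → Fin (suc m) → Carrier) →
    (∀ j → A zero (suc j) ≡ 0#) → det R A ≡ A zero zero * det R (λ i j → A (suc i) (suc j))
  det-firstRow-sparse {m} A row₀ = begin
    1# * A zero zero * d + sumFin R term
      ≡⟨ cong (1# * A zero zero * d +_)
              (sumFin-zero term λ j → laplace-term-vanishes _ _ (row₀ j)) ⟩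
    1# * A zero zero * d + 0#  ≡⟨ +-identityʳ _ ⟩
    1# * A zero zero * d       ≡⟨ cong (_* d) (*-identityˡ _) ⟩
    A zero zero * d            ∎
    where
    d : Carrier
    d = det R (λ i j → A (suc i) (suc j))

    term : Fin m → Carrier
    term = λ j → altSign R (Fin.toℕ (suc j)) * A zero (suc j) *
                 det R (λ r c → A (suc r) (punchIn (suc j) c))

  det-equalColumns01 : ∀ {m} (A : Fin (suc (suc m)) → Fin (suc (suc m)) → Carrier) →
    (∀ i → A i zero ≡ A i (suc zero)) → det R A ≡ 0#
  det-equalColumns01 {m} A col₀≡col₁ = begin
    1# * x * d + (- 1# * A zero (suc zero) * d′ + rest m A)
      ≡⟨ cong₂ (λ y e → 1# * x * d + (- 1# * y * e + rest m A))
               (sym (col₀≡col₁ zero))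
               d′≡d ⟩
    1# * x * d + (- 1# * x * d + rest m A)
      ≡⟨ cong (λ s → 1# * x * d + (- 1# * x * d + s)) (rest≡0 m A col₀≡col₁) ⟩
    1# * x * d + (- 1# * x * d + 0#)
      ≡⟨ cong₂ _+_ (cong (_* d) (*-identityˡ x))
                   (trans (+-identityʳ _) (trans (cong (_* d) (-1*x≈-x x)) (sym (-‿distribˡ-* x d)))) ⟩
    x * d + - (x * d)  ≡⟨ -‿inverseʳ (x * d) ⟩
    0#                 ∎
    where
    x d d′ : Carrier
    x  = A zero zero
    d  = det R (λ r c → A (suc r) (suc c))
    d′ = det R (λ r c → A (suc r) (punchIn (suc zero) c))

    d′≡d : d′ ≡ d
    d′≡d = det-cong {A = λ r c → A (suc r) (punchIn (suc zero) c)} {B = λ r c → A (suc r) (suc c)}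
      λ { r zero → col₀≡col₁ (suc r) ; r (suc c) → refl }

    rest : ∀ k → (Fin (suc (suc k)) → Fin (suc (suc k)) → Carrier) → Carrier
    rest k B = sumFin R λ j →
      altSign R (Fin.toℕ (suc (suc j))) * B zero (suc (suc j)) *
      det R (λ r c → B (suc r) (punchIn (suc (suc j)) c))

    -- Deleting a column other than the first two leaves them equal, so the remaining
    -- Laplace terms vanish by induction.
    rest≡0 : ∀ k B → (∀ i → B i zero ≡ B i (suc zero)) → rest k B ≡ 0#
    rest≡0 zero    B _        = refl
    rest≡0 (suc k) B col₀≡col₁ = sumFin-zero _ λ j →
      trans (cong (altSign R (Fin.toℕ (suc (suc j))) * B zero (suc (suc j)) *_)
                  (det-equalColumns01 (λ r c → B (suc r) (punchIn (suc (suc j)) c))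
                                      (col₀≡col₁ ∘ suc)))
            (zeroʳ _)

  minor-nonneg : ∀ {N : InfMatrix R} → TotallyPositive R N →
    ∀ {m} (r c : Fin m → ℕ) → SI r → SI c →
    {A : Fin m → Fin m → Carrier} → (∀ i j → A i j ≡ N (r i) (c j)) → 0# ≤ det R A
  minor-nonneg tp {m} r c sir sic A≡N =
    subst (0# ≤_) (det-cong λ i j → sym (A≡N i j)) (tp m r c sir sic)

  TotallyPositive-cong : ∀ {M N : InfMatrix R} → (∀ n k → M n k ≡ N n k) →
    TotallyPositive R N → TotallyPositive R M
  TotallyPositive-cong {N = N} M≡N tp m r c sir sic =
    minor-nonneg {N} tp r c sir sic (λ i j → M≡N (r i) (c j))

  duplicateFirstColumn : InfMatrix R → InfMatrix R
  duplicateFirstColumn N n k = N n (ℕ.pred k)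

  -- A minor of the duplicated matrix either uses both copies of the first column
  -- (c₀ = 0, c₁ = 1) and vanishes, or has pred ∘ c strictly increasing.
  duplicateFirstColumn-totallyPositive : ∀ {N : InfMatrix R} →
    TotallyPositive R N → TotallyPositive R (duplicateFirstColumn N)
  duplicateFirstColumn-totallyPositive tp zero r c sir sic = tp zero r c sir sic
  duplicateFirstColumn-totallyPositive {N} tp (suc m) r c sir sic
    with ℕ.m≤n⇒m<n∨m≡n (z≤n {c zero})
  ... | inj₁ 0<c₀ = tp _ r (ℕ.pred ∘ c) sir
                      (pred-strictlyIncreasing sic λ i _ _ → inj₁ (positive-from-head sic 0<c₀ i))
  duplicateFirstColumn-totallyPositive tp (suc zero) r c sir sic | inj₂ _ =
    tp _ r (ℕ.pred ∘ c) sir (pred-strictlyIncreasing sic λ { zero zero () })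
  duplicateFirstColumn-totallyPositive {N} tp (suc (suc m)) r c sir sic | inj₂ 0≡c₀
    with ℕ.m≤n⇒m<n∨m≡n (tail-positive sic zero)
  ...   | inj₁ 1<c₁ = tp _ r (ℕ.pred ∘ c) sir (pred-strictlyIncreasing sic λ
                        { i zero ()
                        ; i (suc j) _ → inj₂ (ℕ.≤-trans 1<c₁ (second≤tail sic j)) })
  ...   | inj₂ 1≡c₁ = ≤-reflexive (sym (det-equalColumns01 (λ i j → N (r i) (ℕ.pred (c j))) λ i →
                        cong (N (r i)) (trans (sym (cong ℕ.pred 0≡c₀)) (cong ℕ.pred 1≡c₁))))

  prependRow : Carrier → InfMatrix R → InfMatrix R
  prependRow α N zero    zero    = α
  prependRow α N zero    (suc k) = 0#
  prependRow α N (suc n) k       = N n k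

  prependRow-top-nonneg : ∀ {α} {N : InfMatrix R} → 0# ≤ α → ∀ k → 0# ≤ prependRow α N zero k
  prependRow-top-nonneg 0≤α zero    = 0≤α
  prependRow-top-nonneg 0≤α (suc k) = ≤-reflexive refl

  prependRow-below-top : ∀ {α} {N : InfMatrix R} {n} → 1 ℕ.≤ n → ∀ k →
    prependRow α N n k ≡ N (ℕ.pred n) k
  prependRow-below-top (s≤s _) k = refl

  prependRow-totallyPositive : ∀ {α} {N : InfMatrix R} → 0# ≤ α →
    TotallyPositive R N → TotallyPositive R (prependRow α N)
  prependRow-totallyPositive 0≤α tp zero r c sir sic = tp zero r c sir sic
  prependRow-totallyPositive {α} {N} 0≤α tp (suc m) r c sir sic
    with ℕ.m≤n⇒m<n∨m≡n (z≤n {r zero})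
  ... | inj₁ 0<r₀ = minor-nonneg {N} tp (ℕ.pred ∘ r) c
                      (pred-strictlyIncreasing sir λ i _ _ → inj₁ (positive i)) sic
                      (λ i j → prependRow-below-top {α} {N} (positive i) (c j))
    where
    positive : ∀ i → 1 ℕ.≤ r i
    positive = positive-from-head sir 0<r₀
  ... | inj₂ 0≡r₀ =
    subst (0# ≤_) (sym (det-firstRow-sparse (λ i j → prependRow α N (r i) (c j)) λ j →
                         subst (λ n → prependRow α N n (c (suc j)) ≡ 0#) 0≡r₀
                               (cornerless (tail-positive sic j))))
      (*-nonneg (subst (λ n → 0# ≤ prependRow α N n (c zero)) 0≡r₀
                       (prependRow-top-nonneg 0≤α (c zero)))
                (prependRow-totallyPositive 0≤α tp m (r ∘ suc) (c ∘ suc)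
                   (tail-strictlyIncreasing sir) (tail-strictlyIncreasing sic)))
    where
    cornerless : ∀ {k} → 1 ℕ.≤ k → prependRow α N zero k ≡ 0#
    cornerless (s≤s _) = refl

  cdAlmostRiordan≡prependRow : ∀ (g f₁ f₂ : PowerSeries R) α n k →
    cdAlmostRiordan R (psAdd R (psT R g) (psConst R α)) g f₁ f₂ n k ≡
    prependRow α (duplicateFirstColumn (cdRiordan R g f₁ f₂)) n k
  cdAlmostRiordan≡prependRow g f₁ f₂ α zero    zero    = +-identityˡ α
  cdAlmostRiordan≡prependRow g f₁ f₂ α zero    (suc k) = refl
  cdAlmostRiordan≡prependRow g f₁ f₂ α (suc n) zero    =
    trans (+-identityʳ (g n)) (sym (psMul-identityʳ g n))
  cdAlmostRiordan≡prependRow g f₁ f₂ α (suc n) (suc k) = refl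

theorem5p5 : (R : RealField) → (g f₁ f₂ : PowerSeries R) →
    Even R g → ¬ (g 0 ≡ RealField.0# R) →
    Odd R f₁ → HasOrder1 R f₁ → Odd R f₂ → HasOrder1 R f₂ →
    TotallyPositive R (cdRiordan R g f₁ f₂) →
    (α : RealField.Carrier R) → RealField._<_ R (RealField.0# R) α →
    TotallyPositive R (cdAlmostRiordan R (psAdd R (psT R g) (psConst R α)) g f₁ f₂)
theorem5p5 R g f₁ f₂ _ _ _ _ _ _ tp α (0≤α , _) =
  TotallyPositive-cong R (cdAlmostRiordan≡prependRow R g f₁ f₂ α)
    (prependRow-totallyPositive R 0≤α
      (duplicateFirstColumn-totallyPositive R {cdRiordan R g f₁ f₂} tp))
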